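{- Let $p\ge 3$, $q\ge 3$, and let $K_puK_q$ denote the union of two complete graphs $K_p$ and $K_q$ sharing exactly one common vertex $u$. Let $t\ge s\ge 1$. Let $G$ be obtained from $K_puK_q$ by attaching a path $P_t$ at some vertex $w_1\in V(K_p)\setminus\{u\}$ and a path $P_s$ at some vertex $v_1\in V(K_q)\setminus\{u\}$, and possibly attaching some connected graphs at other vertices of $V(K_puK_q)\setminus\{u,v_1,w_1\}$. Let $G'$ be obtained from $G$ by deleting all edges of $K_q$ incident to $v_1$ except $v_1u$, and adding all possible edges between each vertex of $V(K_q)\setminus\{v_1\}$ and each vertex of $V(K_p)$. Then $H(G)<H(G')$.
   Context: All graphs are finite and simple. For a graph $G$, $d_G(u,v)$ is the length of a shortest $u$–$v$ path, and the Harary index is $H(G)=\sum_{\{u,v\}\subseteq V(G),\,u\neq v} \frac{1}{d_G(u,v)}$ (sum over unordered pairs of distinct vertices). $P_m$ denotes a path on $m$ vertices; attaching a path $P_m$ at a vertex $x$ of a graph means identifying one end vertex of a new path $P_m$ (vertex-disjoint from the graph) with $x$ (so $P_1$ attached at $x$ adds nothing). Attaching a connected graph at a vertex $x$ means identifying one of its vertices with $x$, the graph being otherwise vertex-disjoint from the rest. -}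

module Defs where

open import Data.Nat using (ℕ; zero; suc; _∸_)
open import Data.Bool using (Bool; true; false; _∧_; _∨_; not; if_then_else_)
open import Data.Fin using (Fin; toℕ) renaming (zero to fzero; suc to fsuc)
import Data.Fin as Fin
open import Data.Sum using (_⊎_; inj₁; inj₂)
open import Data.Sum.Properties using (≡-dec)
open import Data.List using (List; []; _∷_; map; _++_; concatMap; length; foldr; allFin; lookup)
open import Data.Bool.ListAction using (any)
open import Relation.Nullary using (yes; no)
open import Data.Product using (∃)
open import Data.Integer using (+_)
open import Data.Rational using (ℚ; 0ℚ; _/_; _+_)
open import Relation.Nullary.Decidable using (⌊_⌋)
open import Relation.Binary.PropositionalEquality using (_≡_; refl)
open import Relation.Binary.Definitions using (DecidableEquality)
import Data.Nat as ℕ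

FinAdj : ℕ → Set
FinAdj n = Fin n → Fin n → Bool

record IsSimple {n : ℕ} (A : FinAdj n) : Set where
  field
    irrefl : ∀ i → A i i ≡ false
    sym    : ∀ i j → A i j ≡ A j i

reach : ∀ {n} → FinAdj n → ℕ → Fin n → Fin n → Bool
reach A zero    u v = ⌊ u Fin.≟ v ⌋
reach {n} A (suc k) u v =
  reach A k u v ∨ any (λ w → reach A k u w ∧ A w v) (allFin n)

Connected : ∀ {n} → FinAdj n → Set
Connected A = ∀ u v → ∃ λ k → reach A k u v ≡ true

-- distance = least k with a walk of length ≤ k (search bounded by n,
-- which suffices in a connected graph on n vertices).
search : ∀ {n} → FinAdj n → Fin n → Fin n → ℕ → ℕ → ℕ
search A u v k zero    = k
search A u v k (suc f) = if reach A k u v then k else search A u v (suc k) f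

dist : ∀ {n} → FinAdj n → Fin n → Fin n → ℕ
dist {n} A u v = search A u v 0 n

recip : ℕ → ℚ
recip zero    = 0ℚ
recip (suc k) = + 1 / suc k

sumℚ : List ℚ → ℚ
sumℚ = foldr _+_ 0ℚ

harary : ∀ {n} → FinAdj n → ℚ
harary {n} A =
  sumℚ (concatMap (λ i → concatMap (λ j →
     if ⌊ toℕ i ℕ.<? toℕ j ⌋ then recip (dist A i j) ∷ [] else []) (allFin n)) (allFin n))

-- Vertices of K_p u K_q: inj₁ i (i : Fin p) are the vertices of K_p
-- (the shared vertex u is one of them); inj₂ j (j : Fin (q ∸ 1)) are the
-- vertices of K_q other than u.
Core : ℕ → ℕ → Set
Core p q = Fin p ⊎ Fin (q ∸ 1)

core-≟ : ∀ {p q} → DecidableEquality (Core p q)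
core-≟ = ≡-dec Fin._≟_ Fin._≟_

_==ᶠ_ : ∀ {n} → Fin n → Fin n → Bool
i ==ᶠ j = ⌊ i Fin.≟ j ⌋

module Construction
  (p q t s : ℕ) (u w₁ : Fin p) (v₁ : Fin (q ∸ 1))
  -- at each core vertex x a connected graph A x on Fin (suc (m x)) is
  -- attached, its vertex fzero being identified with x
  (m : Core p q → ℕ)
  (A : (x : Core p q) → FinAdj (suc (m x)))
  where

  coreAdjG : Core p q → Core p q → Bool
  coreAdjG (inj₁ i) (inj₁ j) = not (i ==ᶠ j)
  coreAdjG (inj₂ i) (inj₂ j) = not (i ==ᶠ j)
  coreAdjG (inj₁ i) (inj₂ j) = i ==ᶠ u
  coreAdjG (inj₂ i) (inj₁ j) = j ==ᶠ u

  coreAdjG' : Core p q → Core p q → Bool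
  coreAdjG' (inj₁ i) (inj₁ j) = not (i ==ᶠ j)
  coreAdjG' (inj₂ i) (inj₂ j) = not (i ==ᶠ j) ∧ not (i ==ᶠ v₁) ∧ not (j ==ᶠ v₁)
  coreAdjG' (inj₁ i) (inj₂ j) = if j ==ᶠ v₁ then i ==ᶠ u else true
  coreAdjG' (inj₂ i) (inj₁ j) = if i ==ᶠ v₁ then j ==ᶠ u else true

  data Vtx : Set where
    core  : Core p q → Vtx
    pathT : Fin (t ∸ 1) → Vtx          -- pathT i is at distance i+1 from w₁ along P_t
    pathS : Fin (s ∸ 1) → Vtx          -- pathS i is at distance i+1 from v₁ along P_s
    extra : (x : Core p q) → Fin (m x) → Vtx   -- extra x i is vertex fsuc i of A x

  allCore : List (Core p q)
  allCore = map inj₁ (allFin p) ++ map inj₂ (allFin (q ∸ 1))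

  enum : List Vtx
  enum = map core allCore ++ map pathT (allFin (t ∸ 1)) ++ map pathS (allFin (s ∸ 1))
         ++ concatMap (λ x → map (extra x) (allFin (m x))) allCore

  half : (Core p q → Core p q → Bool) → Vtx → Vtx → Bool
  half c (core x) (core y) = c x y
  half c (core x) (pathT i) = ⌊ core-≟ {p} {q} x (inj₁ w₁) ⌋ ∧ ⌊ toℕ i ℕ.≟ 0 ⌋
  half c (core x) (pathS i) = ⌊ core-≟ {p} {q} x (inj₂ v₁) ⌋ ∧ ⌊ toℕ i ℕ.≟ 0 ⌋
  half c (pathT i) (pathT j) = ⌊ suc (toℕ i) ℕ.≟ toℕ j ⌋
  half c (pathS i) (pathS j) = ⌊ suc (toℕ i) ℕ.≟ toℕ j ⌋
  half c (core x) (extra y j) with core-≟ {p} {q} x y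
  ... | yes refl = A x fzero (fsuc j)
  ... | no _ = false
  half c (extra x i) (extra y j) with core-≟ {p} {q} x y
  ... | yes refl = A x (fsuc i) (fsuc j)
  ... | no _ = false
  half c _ _ = false

  adjV : (Core p q → Core p q → Bool) → Vtx → Vtx → Bool
  adjV c a b = half c a b ∨ half c b a

  N : ℕ
  N = length enum

  adjG : FinAdj N
  adjG i j = adjV coreAdjG (lookup enum i) (lookup enum j)

  adjG' : FinAdj N
  adjG' i j = adjV coreAdjG' (lookup enum i) (lookup enum j)

  HG : ℚ
  HG = harary adjG

  HG' : ℚ
  HG' = harary adjG'

-- Let X consist of the vertices of K_q other than u and v₁ together with the graphs attached
-- there. Count 2H as a sum over ordered pairs, reweighted so that a pair with exactly one end
-- in X is counted twice from that end and never from the other. Pairs outside X are no farther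
-- apart in G′: contracting X onto u maps edges of G to edges or loops of G′. For x ∈ X, let σ be
-- the involution exchanging w₁ with v₁ and P_s with the first s − 1 vertices of P_t beyond w₁;
-- then d_G′(x, σ y) ≤ d_G(x, y), since three such maps fix X and, at every y, one of them
-- agrees with σ. Reindexing each row from x by σ gives H(G) ≤ H(G′), strictly because a vertex
-- of K_q ∖ {u, v₁} and one of K_p ∖ {u, w₁} are at distance 2 in G and adjacent in G′.

module Submission where

open import Defs
open import Data.Bool using (Bool; true; false; _∧_; _∨_; not; if_then_else_)
import Data.Bool.Properties as 𝔹P
open import Data.Bool.ListAction using (any)
open import Data.Empty using (⊥; ⊥-elim)
open import Data.Fin as Fin using (Fin; toℕ) renaming (zero to fzero; suc to fsuc)
import Data.Fin.Properties as FinP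
open import Data.Fin.Permutation using (Permutation′; permutation; _⟨$⟩ʳ_)
open import Data.Integer as ℤ using (+≤+; +<+)
open import Data.List using (List; []; _∷_; map; _++_; concatMap; allFin; tabulate; lookup)
import Data.List.Properties as ListP
open import Data.List.Membership.Propositional using (_∈_)
import Data.List.Membership.Propositional.Properties as ∈P
open import Data.List.Relation.Unary.Any as Any using (here; there)
import Data.List.Relation.Unary.Any.Properties as AnyP
import Data.List.Relation.Unary.AllPairs as AllPairs
import Data.List.Relation.Unary.AllPairs.Properties as AllPairsP
import Data.List.Relation.Unary.Unique.Propositional.Properties as UniqueP
open import Data.List.Relation.Binary.Disjoint.Propositional using (Disjoint)
import Data.List.Relation.Unary.All as All
open import Data.List.Relation.Unary.Unique.Propositional using (Unique)
open import Data.Nat as ℕ using (ℕ; zero; suc; z≤n; s≤s; _≤_; _∸_)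
open import Data.Nat.Coprimality using (1-coprimeTo)
import Data.Nat.Properties as ℕP
open import Data.Product using (∃; _×_; _,_; proj₁; proj₂)
open import Data.Rational as ℚ using (ℚ; 0ℚ; mkℚ; _+_; _<_; *≤*; *<*)
import Data.Rational.Properties as ℚP
open import Algebra.Properties.CommutativeMonoid.Sum ℚP.+-0-commutativeMonoid
  using (sum; ∑-comm; ∑-distrib-+; ∑-permute; sum-cong-≗)
open import Data.Sum using (_⊎_; inj₁; inj₂; swap)
open import Relation.Binary.Definitions using (tri<; tri≈; tri>)
open import Relation.Binary.PropositionalEquality
open import Relation.Nullary using (Dec; yes; no; ¬_)
open import Relation.Nullary.Decidable using (⌊_⌋)

∨-trueˡ : ∀ {a} b → a ≡ true → a ∨ b ≡ true
∨-trueˡ b refl = refl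

∨-trueʳ : ∀ a {b} → b ≡ true → a ∨ b ≡ true
∨-trueʳ true  refl = refl
∨-trueʳ false refl = refl

∨-true⁻ : ∀ a {b} → a ∨ b ≡ true → a ≡ true ⊎ b ≡ true
∨-true⁻ true  _ = inj₁ refl
∨-true⁻ false h = inj₂ h

∧-true⁺ : ∀ {a b} → a ≡ true → b ≡ true → a ∧ b ≡ true
∧-true⁺ refl refl = refl

∧-true⁻ : ∀ a {b} → a ∧ b ≡ true → a ≡ true × b ≡ true
∧-true⁻ true h = refl , h

≡-from-true⇔ : ∀ {x y : Bool} → (x ≡ true → y ≡ true) → (y ≡ true → x ≡ true) → x ≡ y
≡-from-true⇔ {true}  {true}  _ _ = refl
≡-from-true⇔ {true}  {false} f _ = sym (f refl)
≡-from-true⇔ {false} {true}  _ g = g refl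
≡-from-true⇔ {false} {false} _ _ = refl

any-true⁺ : ∀ {X : Set} (f : X → Bool) {xs x} → x ∈ xs → f x ≡ true → any f xs ≡ true
any-true⁺ f (here refl) e = ∨-trueˡ _ e
any-true⁺ f {y ∷ _} (there x∈) e = ∨-trueʳ (f y) (any-true⁺ f x∈ e)

any-true⁻ : ∀ {X : Set} (f : X → Bool) xs → any f xs ≡ true → ∃ λ x → f x ≡ true
any-true⁻ f (x ∷ xs) h with ∨-true⁻ (f x) h
... | inj₁ e = x , e
... | inj₂ e = any-true⁻ f xs e

isYes-true : ∀ {P : Set} (d : Dec P) → P → ⌊ d ⌋ ≡ true
isYes-true (yes _) _ = refl
isYes-true (no ¬p) p = ⊥-elim (¬p p)

isYes-false : ∀ {P : Set} (d : Dec P) → ¬ P → ⌊ d ⌋ ≡ false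
isYes-false (yes p) ¬p = ⊥-elim (¬p p)
isYes-false (no _)  _  = refl

isYes-sound : ∀ {P : Set} (d : Dec P) → ⌊ d ⌋ ≡ true → P
isYes-sound (yes p) _ = p

module _ {n : ℕ} (A : FinAdj n) where

  reach-weaken : ∀ k {a b} → reach A k a b ≡ true → reach A (suc k) a b ≡ true
  reach-weaken k = ∨-trueˡ _

  reach-snoc : ∀ k {a w b} → reach A k a w ≡ true → A w b ≡ true → reach A (suc k) a b ≡ true
  reach-snoc k {a} {w} {b} h e =
    ∨-trueʳ (reach A k a b) (any-true⁺ (λ z → reach A k a z ∧ A z b) (∈P.∈-allFin w) (∧-true⁺ h e))

  reach-suc⁻ : ∀ k {a b} → reach A (suc k) a b ≡ true →
    reach A k a b ≡ true ⊎ ∃ λ w → reach A k a w ≡ true × A w b ≡ true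
  reach-suc⁻ k {a} {b} h with ∨-true⁻ (reach A k a b) h
  ... | inj₁ e = inj₁ e
  ... | inj₂ e with any-true⁻ (λ z → reach A k a z ∧ A z b) (allFin n) e
  ... | w , e′ = inj₂ (w , ∧-true⁻ (reach A k a w) e′)

  reach-zero⁻ : ∀ {a b} → reach A 0 a b ≡ true → a ≡ b
  reach-zero⁻ = isYes-sound (_ Fin.≟ _)

  reach-refl : ∀ a → reach A 0 a a ≡ true
  reach-refl a = isYes-true (a Fin.≟ a) refl

  reach-cons : ∀ k {a w b} → A a w ≡ true → reach A k w b ≡ true → reach A (suc k) a b ≡ true
  reach-cons zero {a} e h with reach-zero⁻ h
  ... | refl = reach-snoc 0 (reach-refl a) e
  reach-cons (suc k) e h with reach-suc⁻ k h
  ... | inj₁ h′ = reach-weaken (suc k) (reach-cons k e h′)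
  ... | inj₂ (_ , h′ , e′) = reach-snoc (suc k) (reach-cons k e h′) e′

  reach-sym : (∀ i j → A i j ≡ A j i) → ∀ k {a b} → reach A k a b ≡ true → reach A k b a ≡ true
  reach-sym S zero {a} h with reach-zero⁻ h
  ... | refl = reach-refl a
  reach-sym S (suc k) h with reach-suc⁻ k h
  ... | inj₁ h′ = reach-weaken k (reach-sym S k h′)
  ... | inj₂ (_ , h′ , e) = reach-cons k (trans (S _ _) e) (reach-sym S k h′)

WeakHom : ∀ {n n′} → FinAdj n → FinAdj n′ → (Fin n → Fin n′) → Set
WeakHom A A′ f = ∀ a b → A a b ≡ true → f a ≡ f b ⊎ A′ (f a) (f b) ≡ true

reach-map : ∀ {n n′} {A : FinAdj n} {A′ : FinAdj n′} {f : Fin n → Fin n′} → WeakHom A A′ f →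
  ∀ k {a b} → reach A k a b ≡ true → reach A′ k (f a) (f b) ≡ true
reach-map {A = A} {A′} {f} H zero {a} h with reach-zero⁻ A h
... | refl = reach-refl A′ (f a)
reach-map {A = A} {A′} {f} H (suc k) {a} h with reach-suc⁻ A k h
... | inj₁ h′ = reach-weaken A′ k (reach-map H k h′)
... | inj₂ (w , h′ , e) with H w _ e
... | inj₁ fw≡fb = reach-weaken A′ k (subst (λ z → reach A′ k (f a) z ≡ true) fw≡fb (reach-map H k h′))
... | inj₂ e′ = reach-snoc A′ k (reach-map H k h′) e′

module _ {n : ℕ} (A : FinAdj n) where

  search-≥ : ∀ a b k f → k ℕ.≤ search A a b k f
  search-≥ a b k zero = ℕP.≤-refl
  search-≥ a b k (suc f) with reach A k a b
  ... | true  = ℕP.≤-refl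
  ... | false = ℕP.≤-trans (ℕP.n≤1+n k) (search-≥ a b (suc k) f)

  search-found : ∀ {a b k} f → reach A k a b ≡ true → search A a b k (suc f) ≡ k
  search-found f h rewrite h = refl

  search-skip : ∀ {a b k} f → reach A k a b ≡ false → search A a b k (suc f) ≡ search A a b (suc k) f
  search-skip f h rewrite h = refl

  search-cong : ∀ {a b a′ b′} → (∀ k → reach A k a b ≡ reach A k a′ b′) →
    ∀ k f → search A a b k f ≡ search A a′ b′ k f
  search-cong H k zero = refl
  search-cong H k (suc f) rewrite H k =
    cong (if reach A k _ _ then k else_) (search-cong H (suc k) f)

dist-refl : ∀ {n} (A : FinAdj n) a → dist A a a ≡ 0
dist-refl {suc n} A a = search-found A n (reach-refl A a)

search-anti : ∀ {n n′} (A : FinAdj n) (A′ : FinAdj n′) {a b a′ b′} →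
  (∀ k → reach A k a b ≡ true → reach A′ k a′ b′ ≡ true) →
  ∀ k f → search A′ a′ b′ k f ℕ.≤ search A a b k f
search-anti A A′ H k zero = ℕP.≤-refl
search-anti A A′ {a} {b} {a′} {b′} H k (suc f) with reach A k a b in eq
... | true rewrite H k eq = ℕP.≤-refl
... | false with reach A′ k a′ b′
...   | true  = ℕP.≤-trans (ℕP.n≤1+n k) (search-≥ A a b (suc k) f)
...   | false = search-anti A A′ H (suc k) f

dist-map : ∀ {n} {A A′ : FinAdj n} {f : Fin n → Fin n} → WeakHom A A′ f →
  ∀ a b → dist A′ (f a) (f b) ℕ.≤ dist A a b
dist-map {n} {A} {A′} H a b = search-anti A A′ (λ k → reach-map H k) 0 n

dist-sym : ∀ {n} (A : FinAdj n) → (∀ i j → A i j ≡ A j i) → ∀ a b → dist A a b ≡ dist A b a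
dist-sym {n} A S a b = search-cong A (λ k → ≡-from-true⇔ (reach-sym A S k) (reach-sym A S k)) 0 n

dist-pos : ∀ {n} (A : FinAdj n) {a b} → a ≢ b → 1 ℕ.≤ dist A a b
dist-pos {suc n} A {a} {b} a≢b
  rewrite search-skip A {a} {b} {0} n (isYes-false (a Fin.≟ b) a≢b) = search-≥ A a b 1 n

dist-adjacent : ∀ {n} (A : FinAdj n) {a b} → a ≢ b → A a b ≡ true → dist A a b ≡ 1
dist-adjacent {suc zero} A {fzero} {fzero} a≢b _ = ⊥-elim (a≢b refl)
dist-adjacent {suc (suc n)} A {a} {b} a≢b e
  rewrite search-skip A {a} {b} {0} (suc n) (isYes-false (a Fin.≟ b) a≢b)
        | search-found A {a} {b} {1} n (reach-snoc A 0 (reach-refl A a) e) = refl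

reach-one-nonadjacent : ∀ {n} (A : FinAdj n) {a b} → a ≢ b → A a b ≡ false → reach A 1 a b ≡ false
reach-one-nonadjacent A {a} {b} a≢b e = ≡-from-true⇔ impossible λ ()
  where
    impossible : reach A 1 a b ≡ true → false ≡ true
    impossible h with reach-suc⁻ A 0 h
    ... | inj₁ h₀ = ⊥-elim (a≢b (reach-zero⁻ A h₀))
    ... | inj₂ (_ , h₀ , e′) with reach-zero⁻ A h₀
    ...   | refl = trans (sym e) e′

dist-nonadjacent : ∀ {n} (A : FinAdj n) {a b} → a ≢ b → A a b ≡ false → 2 ℕ.≤ dist A a b
dist-nonadjacent {suc zero} A {fzero} {fzero} a≢b _ = ⊥-elim (a≢b refl)
dist-nonadjacent {suc (suc n)} A {a} {b} a≢b e
  rewrite search-skip A {a} {b} {0} (suc n) (isYes-false (a Fin.≟ b) a≢b)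
        | search-skip A {a} {b} {1} n (reach-one-nonadjacent A a≢b e) = search-≥ A a b 2 n

recip-suc : ∀ k → recip (suc k) ≡ mkℚ (ℤ.+ 1) k (1-coprimeTo (suc k))
recip-suc k = ℚP.normalize-coprime (1-coprimeTo (suc k))

recip-nonneg : ∀ d → 0ℚ ℚ.≤ recip d
recip-nonneg zero = ℚP.≤-refl
recip-nonneg (suc k) rewrite recip-suc k = *≤* (+≤+ z≤n)

recip-anti : ∀ {d d′} → 1 ℕ.≤ d′ → d′ ℕ.≤ d → recip d ℚ.≤ recip d′
recip-anti {suc d} {suc d′} _ (s≤s d′≤d) rewrite recip-suc d | recip-suc d′ =
  *≤* (+≤+ (subst₂ ℕ._≤_ (sym (ℕP.+-identityʳ (suc d′))) (sym (ℕP.+-identityʳ (suc d))) (s≤s d′≤d)))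

recip-<-recip1 : ∀ {d} → 2 ℕ.≤ d → recip d ℚ.< recip 1
recip-<-recip1 {suc (suc d)} (s≤s (s≤s _)) rewrite recip-suc (suc d) | recip-suc 0 = *<* (+<+ (s≤s (s≤s z≤n)))

double-<-cancel : ∀ {x y : ℚ} → x + x ℚ.< y + y → x ℚ.< y
double-<-cancel {x} {y} h with ℚP.<-cmp x y
... | tri< x<y _ _ = x<y
... | tri≈ _ refl _ = ⊥-elim (ℚP.<-irrefl refl h)
... | tri> _ _ y<x = ⊥-elim (ℚP.<-asym h (ℚP.+-mono-< y<x y<x))

sumℚ-++ : ∀ xs ys → sumℚ (xs ++ ys) ≡ sumℚ xs + sumℚ ys
sumℚ-++ [] ys = sym (ℚP.+-identityˡ _)
sumℚ-++ (x ∷ xs) ys rewrite sumℚ-++ xs ys = sym (ℚP.+-assoc x _ _)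

sumℚ-concatMap : ∀ {X : Set} (g : X → List ℚ) xs →
  sumℚ (concatMap g xs) ≡ sumℚ (map (λ x → sumℚ (g x)) xs)
sumℚ-concatMap g [] = refl
sumℚ-concatMap g (x ∷ xs) = trans (sumℚ-++ (g x) (concatMap g xs)) (cong (sumℚ (g x) +_) (sumℚ-concatMap g xs))

sumℚ-tabulate : ∀ {n} (f : Fin n → ℚ) → sumℚ (tabulate f) ≡ sum f
sumℚ-tabulate {zero} f = refl
sumℚ-tabulate {suc n} f = cong (f fzero +_) (sumℚ-tabulate (λ i → f (fsuc i)))

sumℚ-allFin : ∀ {n} (f : Fin n → ℚ) → sumℚ (map f (allFin n)) ≡ sum f
sumℚ-allFin {n} f = trans (cong sumℚ (ListP.map-tabulate (λ i → i) f)) (sumℚ-tabulate f)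

keepIf : Bool → ℚ → ℚ
keepIf c x = if c then x else 0ℚ

sumℚ-singletonIf : ∀ c x → sumℚ (if c then x ∷ [] else []) ≡ keepIf c x
sumℚ-singletonIf true x = ℚP.+-identityʳ x
sumℚ-singletonIf false x = refl

sum-mono : ∀ {n} {f g : Fin n → ℚ} → (∀ i → f i ℚ.≤ g i) → sum f ℚ.≤ sum g
sum-mono {zero} h = ℚP.≤-refl
sum-mono {suc n} h = ℚP.+-mono-≤ (h fzero) (sum-mono (λ i → h (fsuc i)))

sum-mono-< : ∀ {n} {f g : Fin n → ℚ} → (∀ i → f i ℚ.≤ g i) → ∀ i₀ → f i₀ ℚ.< g i₀ → sum f ℚ.< sum g
sum-mono-< {suc n} h fzero s = ℚP.+-mono-<-≤ s (sum-mono (λ i → h (fsuc i)))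
sum-mono-< {suc n} h (fsuc i₀) s = ℚP.+-mono-≤-< (h fzero) (sum-mono-< (λ i → h (fsuc i)) i₀ s)

sum-≤-permuted : ∀ {n} (π : Permutation′ n) {f g : Fin n → ℚ} →
  (∀ i → f i ℚ.≤ g (π ⟨$⟩ʳ i)) → sum f ℚ.≤ sum g
sum-≤-permuted π {f} {g} h = ℚP.≤-trans (sum-mono h) (ℚP.≤-reflexive (sym (∑-permute g π)))

sum-<-permuted : ∀ {n} (π : Permutation′ n) {f g : Fin n → ℚ} →
  (∀ i → f i ℚ.≤ g (π ⟨$⟩ʳ i)) → ∀ i₀ → f i₀ ℚ.< g (π ⟨$⟩ʳ i₀) → sum f ℚ.< sum g
sum-<-permuted π {f} {g} h i₀ s = ℚP.<-≤-trans (sum-mono-< h i₀ s) (ℚP.≤-reflexive (sym (∑-permute g π)))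

∑∑-transpose-right : ∀ {n} (F G : Fin n → Fin n → ℚ) →
  sum (λ i → sum (λ j → F i j + G j i)) ≡ sum (λ i → sum (λ j → F i j + G i j))
∑∑-transpose-right F G = begin
    sum (λ i → sum (λ j → F i j + G j i))
  ≡⟨ sum-cong-≗ (λ i → ∑-distrib-+ (F i) (λ j → G j i)) ⟩
    sum (λ i → sum (F i) + sum (λ j → G j i))
  ≡⟨ ∑-distrib-+ (λ i → sum (F i)) (λ i → sum (λ j → G j i)) ⟩
    sum (λ i → sum (F i)) + sum (λ i → sum (λ j → G j i))
  ≡⟨ cong (sum (λ i → sum (F i)) +_) (sym (∑-comm G)) ⟩
    sum (λ i → sum (F i)) + sum (λ i → sum (G i))
  ≡⟨ sym (∑-distrib-+ (λ i → sum (F i)) (λ i → sum (G i))) ⟩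
    sum (λ i → sum (F i) + sum (G i))
  ≡⟨ sum-cong-≗ (λ i → sym (∑-distrib-+ (F i) (G i))) ⟩
    sum (λ i → sum (λ j → F i j + G i j))
  ∎
  where open ≡-Reasoning

harary-∑∑ : ∀ {n} (A : FinAdj n) →
  harary A ≡ sum (λ i → sum (λ j → keepIf ⌊ toℕ i ℕ.<? toℕ j ⌋ (recip (dist A i j))))
harary-∑∑ {n} A = begin
    harary A
  ≡⟨ sumℚ-concatMap _ (allFin n) ⟩
    sumℚ (map (λ i → sumℚ (concatMap (row i) (allFin n))) (allFin n))
  ≡⟨ cong sumℚ (ListP.map-cong row-sum (allFin n)) ⟩
    sumℚ (map (λ i → sum (λ j → keepIf (i<j i j) (recip (dist A i j)))) (allFin n))
  ≡⟨ sumℚ-allFin (λ i → sum (λ j → keepIf (i<j i j) (recip (dist A i j)))) ⟩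
    sum (λ i → sum (λ j → keepIf (i<j i j) (recip (dist A i j))))
  ∎
  where
    open ≡-Reasoning
    i<j : Fin n → Fin n → Bool
    i<j i j = ⌊ toℕ i ℕ.<? toℕ j ⌋
    row : Fin n → Fin n → List ℚ
    row i j = if i<j i j then recip (dist A i j) ∷ [] else []
    row-sum : ∀ i → sumℚ (concatMap (row i) (allFin n)) ≡ sum (λ j → keepIf (i<j i j) (recip (dist A i j)))
    row-sum i = begin
        sumℚ (concatMap (row i) (allFin n))
      ≡⟨ sumℚ-concatMap (row i) (allFin n) ⟩
        sumℚ (map (λ j → sumℚ (row i j)) (allFin n))
      ≡⟨ cong sumℚ (ListP.map-cong (λ j → sumℚ-singletonIf (i<j i j) _) (allFin n)) ⟩
        sumℚ (map (λ j → keepIf (i<j i j) (recip (dist A i j))) (allFin n))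
      ≡⟨ sumℚ-allFin (λ j → keepIf (i<j i j) (recip (dist A i j))) ⟩
        sum (λ j → keepIf (i<j i j) (recip (dist A i j)))
      ∎

∑∑-symmetric : ∀ {n} (φ : Fin n → Fin n → ℚ) → (∀ i j → φ i j ≡ φ j i) → (∀ i → φ i i ≡ 0ℚ) →
  let U = sum (λ i → sum (λ j → keepIf ⌊ toℕ i ℕ.<? toℕ j ⌋ (φ i j))) in
  sum (λ i → sum (λ j → φ i j)) ≡ U + U
∑∑-symmetric {n} φ φ-sym φ-diag = begin
    sum (λ i → sum (λ j → φ i j))
  ≡⟨ sum-cong-≗ (λ i → sum-cong-≗ (λ j → split i j)) ⟩
    sum (λ i → sum (λ j → L i j + L j i))
  ≡⟨ ∑∑-transpose-right L L ⟩
    sum (λ i → sum (λ j → L i j + L i j))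
  ≡⟨ sum-cong-≗ (λ i → ∑-distrib-+ (L i) (L i)) ⟩
    sum (λ i → sum (L i) + sum (L i))
  ≡⟨ ∑-distrib-+ (λ i → sum (L i)) (λ i → sum (L i)) ⟩
    sum (λ i → sum (L i)) + sum (λ i → sum (L i))
  ∎
  where
    open ≡-Reasoning
    L : Fin n → Fin n → ℚ
    L i j = keepIf ⌊ toℕ i ℕ.<? toℕ j ⌋ (φ i j)
    split : ∀ i j → φ i j ≡ L i j + L j i
    split i j with ℕP.<-cmp (toℕ i) (toℕ j)
    ... | tri< i<j _ j≮i
      rewrite isYes-true (toℕ i ℕ.<? toℕ j) i<j | isYes-false (toℕ j ℕ.<? toℕ i) j≮i =
        sym (ℚP.+-identityʳ _)
    ... | tri> i≮j _ j<i
      rewrite isYes-false (toℕ i ℕ.<? toℕ j) i≮j | isYes-true (toℕ j ℕ.<? toℕ i) j<i =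
        trans (φ-sym i j) (sym (ℚP.+-identityˡ _))
    ... | tri≈ i≮j i≡j j≮i
      rewrite isYes-false (toℕ i ℕ.<? toℕ j) i≮j | isYes-false (toℕ j ℕ.<? toℕ i) j≮i
      with FinP.toℕ-injective i≡j
    ...   | refl = trans (φ-diag i) (sym (ℚP.+-identityˡ _))

-- Relative to a vertex set X, a pair with exactly one end in X is counted twice from its X end.
weight : Bool → Bool → ℚ → ℚ
weight true  true  x = x
weight true  false x = x + x
weight false true  x = 0ℚ
weight false false x = x

weight-mono : ∀ a b {x y} → x ℚ.≤ y → weight a b x ℚ.≤ weight a b y
weight-mono true  true  h = h
weight-mono true  false h = ℚP.+-mono-≤ h h
weight-mono false true  h = ℚP.≤-refl
weight-mono false false h = h

∑∑-reweight : ∀ {n} (X : Fin n → Bool) (φ : Fin n → Fin n → ℚ) → (∀ i j → φ i j ≡ φ j i) →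
  sum (λ i → sum (λ j → φ i j)) ≡ sum (λ i → sum (λ j → weight (X i) (X j) (φ i j)))
∑∑-reweight {n} X φ φ-sym = begin
    sum (λ i → sum (λ j → φ i j))
  ≡⟨ sum-cong-≗ (λ i → sum-cong-≗ (λ j → split i j)) ⟩
    sum (λ i → sum (λ j → F i j + G j i))
  ≡⟨ ∑∑-transpose-right F G ⟩
    sum (λ i → sum (λ j → F i j + G i j))
  ≡⟨ sum-cong-≗ (λ i → sum-cong-≗ (λ j → merge i j)) ⟩
    sum (λ i → sum (λ j → weight (X i) (X j) (φ i j)))
  ∎
  where
    open ≡-Reasoning
    F G : Fin n → Fin n → ℚ
    F i j = if X j ∧ not (X i) then 0ℚ else φ i j
    G i j = if X i ∧ not (X j) then φ i j else 0ℚ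
    split : ∀ i j → φ i j ≡ F i j + G j i
    split i j with X i | X j
    ... | true  | true  = sym (ℚP.+-identityʳ _)
    ... | true  | false = sym (ℚP.+-identityʳ _)
    ... | false | true  = trans (φ-sym i j) (sym (ℚP.+-identityˡ _))
    ... | false | false = sym (ℚP.+-identityʳ _)
    merge : ∀ i j → F i j + G i j ≡ weight (X i) (X j) (φ i j)
    merge i j with X i | X j
    ... | true  | true  = ℚP.+-identityʳ _
    ... | true  | false = refl
    ... | false | true  = ℚP.+-identityʳ _
    ... | false | false = ℚP.+-identityʳ _

harary-doubled : ∀ {n} (A : FinAdj n) → (∀ i j → A i j ≡ A j i) → (X : Fin n → Bool) →
  harary A + harary A ≡ sum (λ i → sum (λ j → weight (X i) (X j) (recip (dist A i j))))
harary-doubled A A-sym X = begin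
    harary A + harary A
  ≡⟨ cong₂ _+_ (harary-∑∑ A) (harary-∑∑ A) ⟩
    _
  ≡⟨ sym (∑∑-symmetric φ φ-sym (λ i → cong recip (dist-refl A i))) ⟩
    sum (λ i → sum (λ j → φ i j))
  ≡⟨ ∑∑-reweight X φ φ-sym ⟩
    sum (λ i → sum (λ j → weight (X i) (X j) (φ i j)))
  ∎
  where
    open ≡-Reasoning
    φ = λ i j → recip (dist A i j)
    φ-sym : ∀ i j → φ i j ≡ φ j i
    φ-sym i j = cong recip (dist-sym A A-sym i j)

recip-dist-anti : ∀ {n} (B B′ : FinAdj n) {i j i′ j′} →
  dist B′ i′ j′ ℕ.≤ dist B i j → (i′ ≡ j′ → i ≡ j) → recip (dist B i j) ℚ.≤ recip (dist B′ i′ j′)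
recip-dist-anti B B′ {i} {j} {i′} {j′} d′≤d back with i′ Fin.≟ j′
... | no i′≢j′ = recip-anti (dist-pos B′ i′≢j′) d′≤d
... | yes i′≡j′ with back i′≡j′
...   | refl rewrite dist-refl B i = recip-nonneg (dist B′ i′ j′)

lookup-injective : ∀ {X : Set} {xs : List X} → Unique xs → ∀ i j → lookup xs i ≡ lookup xs j → i ≡ j
lookup-injective (_ AllPairs.∷ _) fzero fzero _ = refl
lookup-injective (x∉ AllPairs.∷ _) fzero (fsuc j) e = ⊥-elim (All.lookup x∉ (∈P.∈-lookup j) e)
lookup-injective (x∉ AllPairs.∷ _) (fsuc i) fzero e = ⊥-elim (All.lookup x∉ (∈P.∈-lookup i) (sym e))
lookup-injective (_ AllPairs.∷ U) (fsuc i) (fsuc j) e = cong fsuc (lookup-injective U i j e)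

fin-other : ∀ n → 2 ℕ.≤ n → (a : Fin n) → ∃ λ c → c ≢ a
fin-other (suc zero) (s≤s ()) fzero
fin-other (suc (suc n)) _ fzero = fsuc fzero , λ ()
fin-other (suc (suc n)) _ (fsuc a) = fzero , λ ()

fin-other₂ : ∀ n → 3 ℕ.≤ n → (a b : Fin n) → ∃ λ c → c ≢ a × c ≢ b
fin-other₂ (suc zero) (s≤s ()) _ _
fin-other₂ (suc (suc zero)) (s≤s (s≤s ())) _ _
fin-other₂ (suc (suc (suc n))) _ fzero fzero = fsuc fzero , (λ ()) , (λ ())
fin-other₂ (suc (suc (suc n))) _ fzero (fsuc fzero) = fsuc (fsuc fzero) , (λ ()) , (λ ())
fin-other₂ (suc (suc (suc n))) _ fzero (fsuc (fsuc b)) = fsuc fzero , (λ ()) , (λ ())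
fin-other₂ (suc (suc (suc n))) _ (fsuc fzero) fzero = fsuc (fsuc fzero) , (λ ()) , (λ ())
fin-other₂ (suc (suc (suc n))) _ (fsuc fzero) (fsuc b) = fzero , (λ ()) , (λ ())
fin-other₂ (suc (suc (suc n))) _ (fsuc (fsuc a)) fzero = fsuc fzero , (λ ()) , (λ ())
fin-other₂ (suc (suc (suc n))) _ (fsuc (fsuc a)) (fsuc b) = fzero , (λ ()) , (λ ())

<-pred⇒suc< : ∀ n {k} → k ℕ.< n ∸ 1 → suc k ℕ.< n
<-pred⇒suc< (suc n) k<n = s≤s k<n

suc<⇒<-pred : ∀ n {k} → suc k ℕ.< n → k ℕ.< n ∸ 1
suc<⇒<-pred (suc n) (s≤s k<n) = k<n

-- The vertex at distance k from r along the path r, P 0, …, P (ℓ-1), stopping at its end.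
along : ∀ {V : Set} → V → ∀ ℓ → (Fin ℓ → V) → ℕ → V
along r ℓ P zero = r
along r ℓ P (suc k) with k ℕ.<? ℓ
... | yes k<ℓ = P (Fin.fromℕ< k<ℓ)
... | no  _   = along r ℓ P k

along-suc : ∀ {V : Set} (r : V) ℓ P {k} (k<ℓ : k ℕ.< ℓ) → along r ℓ P (suc k) ≡ P (Fin.fromℕ< k<ℓ)
along-suc r ℓ P {k} k<ℓ with k ℕ.<? ℓ
... | yes _ = refl
... | no k≮ℓ = ⊥-elim (k≮ℓ k<ℓ)

along-all : ∀ {V : Set} (Q : V → Set) {r ℓ P} → Q r → (∀ i → Q (P i)) → ∀ k → Q (along r ℓ P k)
along-all Q Qr QP zero = Qr
along-all Q {r} {ℓ} {P} Qr QP (suc k) with k ℕ.<? ℓ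
... | yes _ = QP _
... | no  _ = along-all Q Qr QP k

along-step : ∀ {V : Set} (R : V → V → Set) {r ℓ P} →
  (∀ {i} → toℕ i ≡ 0 → R r (P i)) → (∀ {i j} → suc (toℕ i) ≡ toℕ j → R (P i) (P j)) →
  ∀ k → along r ℓ P k ≡ along r ℓ P (suc k) ⊎ R (along r ℓ P k) (along r ℓ P (suc k))
along-step R {r} {ℓ} {P} start step k with k ℕ.<? ℓ
... | no _ = inj₁ refl
along-step R {r} {ℓ} {P} start step zero | yes 0<ℓ = inj₂ (start (FinP.toℕ-fromℕ< 0<ℓ))
along-step R {r} {ℓ} {P} start step (suc k) | yes k+1<ℓ
  rewrite along-suc r ℓ P (ℕP.<-trans (ℕP.n<1+n k) k+1<ℓ) =
    inj₂ (step (trans (cong suc (FinP.toℕ-fromℕ< _)) (sym (FinP.toℕ-fromℕ< k+1<ℓ))))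

module Transformation (p q t s : ℕ) (u w₁ : Fin p) (v₁ : Fin (q ∸ 1)) (m : Core p q → ℕ)
  (A : (x : Core p q) → FinAdj (suc (m x))) where

  open Construction p q t s u w₁ v₁ m A

  kind : Vtx → ℕ
  kind (core _)    = 0
  kind (pathT _)   = 1
  kind (pathS _)   = 2
  kind (extra _ _) = 3

  OfKind : ℕ → List Vtx → Set
  OfKind k xs = ∀ {v} → v ∈ xs → kind v ≡ k

  KindsAbove : ℕ → List Vtx → Set
  KindsAbove k xs = ∀ {v} → v ∈ xs → k ℕ.< kind v

  map-ofKind : ∀ {X : Set} k (f : X → Vtx) xs → (∀ x → kind (f x) ≡ k) → OfKind k (map f xs)
  map-ofKind k f xs f-k v∈ with ∈P.∈-map⁻ f v∈
  ... | x , _ , refl = f-k x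

  ofKind⇒kindsAbove : ∀ {k l} {xs} → OfKind l xs → k ℕ.< l → KindsAbove k xs
  ofKind⇒kindsAbove xs-l k<l v∈ rewrite xs-l v∈ = k<l

  kindsAbove-++ : ∀ k xs ys → KindsAbove k xs → KindsAbove k ys → KindsAbove k (xs ++ ys)
  kindsAbove-++ k xs ys xs-k ys-k v∈ with ∈P.∈-++⁻ xs v∈
  ... | inj₁ v∈xs = xs-k v∈xs
  ... | inj₂ v∈ys = ys-k v∈ys

  ofKind-disjoint : ∀ {k} {xs ys} → OfKind k xs → KindsAbove k ys → Disjoint xs ys
  ofKind-disjoint xs-k ys-k (v∈xs , v∈ys) with ys-k v∈ys
  ... | k<kind rewrite xs-k v∈xs = ℕP.<-irrefl refl k<kind

  extras : Core p q → List Vtx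
  extras x = map (extra x) (allFin (m x))

  extras-ofKind : OfKind 3 (concatMap extras allCore)
  extras-ofKind v∈ with ∈P.∈-concatMap⁻ extras {xs = allCore} v∈
  ... | v∈extras = proj₂ (Any.satisfied (Any.map (λ {x} v∈x → map-ofKind 3 (extra x) _ (λ _ → refl) v∈x) v∈extras))

  allCore-unique : Unique allCore
  allCore-unique = UniqueP.++⁺ (UniqueP.map⁺ (λ { refl → refl }) (UniqueP.allFin⁺ p))
    (UniqueP.map⁺ (λ { refl → refl }) (UniqueP.allFin⁺ (q ∸ 1))) disjoint
    where
      disjoint : Disjoint (map inj₁ (allFin p)) (map inj₂ (allFin (q ∸ 1)))
      disjoint (a , b) with ∈P.∈-map⁻ inj₁ a | ∈P.∈-map⁻ inj₂ b
      ... | _ , _ , refl | _ , _ , ()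

  extras-unique : Unique (concatMap extras allCore)
  extras-unique = UniqueP.concat⁺ (All.tabulate each-unique)
    (AllPairsP.map⁺ (AllPairs.map disjoint allCore-unique))
    where
      each-unique : ∀ {xs} → xs ∈ map extras allCore → Unique xs
      each-unique h with ∈P.∈-map⁻ extras h
      ... | x , _ , refl = UniqueP.map⁺ (λ { refl → refl }) (UniqueP.allFin⁺ (m x))
      disjoint : ∀ {x y} → x ≢ y → Disjoint (extras x) (extras y)
      disjoint {x} {y} x≢y (a , b) with ∈P.∈-map⁻ (extra x) a | ∈P.∈-map⁻ (extra y) b
      ... | _ , _ , refl | _ , _ , refl = x≢y refl

  enum-unique : Unique enum
  enum-unique =
    UniqueP.++⁺ (UniqueP.map⁺ (λ { refl → refl }) allCore-unique)
     (UniqueP.++⁺ (UniqueP.map⁺ (λ { refl → refl }) (UniqueP.allFin⁺ (t ∸ 1)))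
      (UniqueP.++⁺ (UniqueP.map⁺ (λ { refl → refl }) (UniqueP.allFin⁺ (s ∸ 1))) extras-unique
        (ofKind-disjoint pathS-kind (ofKind⇒kindsAbove extras-ofKind ℕP.≤-refl)))
      (ofKind-disjoint pathT-kind
        (kindsAbove-++ 1 _ _ (ofKind⇒kindsAbove pathS-kind ℕP.≤-refl)
                             (ofKind⇒kindsAbove extras-ofKind (ℕP.n≤1+n 2)))))
     (ofKind-disjoint core-kind
       (kindsAbove-++ 0 _ _ (ofKind⇒kindsAbove pathT-kind ℕP.≤-refl)
         (kindsAbove-++ 0 _ _ (ofKind⇒kindsAbove pathS-kind (s≤s z≤n))
                              (ofKind⇒kindsAbove extras-ofKind (s≤s z≤n)))))
    where
      core-kind = map-ofKind 0 core allCore (λ _ → refl)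
      pathT-kind = map-ofKind 1 pathT (allFin (t ∸ 1)) (λ _ → refl)
      pathS-kind = map-ofKind 2 pathS (allFin (s ∸ 1)) (λ _ → refl)

  ∈-allCore : ∀ x → x ∈ allCore
  ∈-allCore (inj₁ i) = ∈P.∈-++⁺ˡ (∈P.∈-map⁺ inj₁ (∈P.∈-allFin i))
  ∈-allCore (inj₂ j) = ∈P.∈-++⁺ʳ (map inj₁ (allFin p)) (∈P.∈-map⁺ inj₂ (∈P.∈-allFin j))

  ∈-enum : ∀ v → v ∈ enum
  ∈-enum (core x) = ∈P.∈-++⁺ˡ (∈P.∈-map⁺ core (∈-allCore x))
  ∈-enum (pathT i) = ∈P.∈-++⁺ʳ (map core allCore) (∈P.∈-++⁺ˡ (∈P.∈-map⁺ pathT (∈P.∈-allFin i)))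
  ∈-enum (pathS i) = ∈P.∈-++⁺ʳ (map core allCore) (∈P.∈-++⁺ʳ (map pathT (allFin (t ∸ 1)))
    (∈P.∈-++⁺ˡ (∈P.∈-map⁺ pathS (∈P.∈-allFin i))))
  ∈-enum (extra x i) = ∈P.∈-++⁺ʳ (map core allCore) (∈P.∈-++⁺ʳ (map pathT (allFin (t ∸ 1)))
    (∈P.∈-++⁺ʳ (map pathS (allFin (s ∸ 1)))
      (∈P.∈-concatMap⁺ extras {xs = allCore}
        (Any.map (λ { refl → ∈P.∈-map⁺ (extra x) (∈P.∈-allFin i) }) (∈-allCore x)))))

  vertex : Fin N → Vtx
  vertex = lookup enum

  index : Vtx → Fin N
  index v = Any.index (∈-enum v)

  vertex-index : ∀ v → vertex (index v) ≡ v
  vertex-index v = sym (AnyP.lookup-index (∈-enum v))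

  index-vertex : ∀ i → index (vertex i) ≡ i
  index-vertex i = lookup-injective enum-unique _ _ (vertex-index (vertex i))

  data Edge (c : Core p q → Core p q → Bool) : Vtx → Vtx → Set where
    coreEdge  : ∀ {x y} → c x y ≡ true → Edge c (core x) (core y)
    pathTRoot : ∀ {i} → toℕ i ≡ 0 → Edge c (core (inj₁ w₁)) (pathT i)
    pathSRoot : ∀ {i} → toℕ i ≡ 0 → Edge c (core (inj₂ v₁)) (pathS i)
    pathTStep : ∀ {i j} → suc (toℕ i) ≡ toℕ j → Edge c (pathT i) (pathT j)
    pathSStep : ∀ {i j} → suc (toℕ i) ≡ toℕ j → Edge c (pathS i) (pathS j)
    extraRoot : ∀ {x j} → A x fzero (fsuc j) ≡ true → Edge c (core x) (extra x j)
    extraEdge : ∀ {x i j} → A x (fsuc i) (fsuc j) ≡ true → Edge c (extra x i) (extra x j)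

  half-sound : ∀ c a b → half c a b ≡ true → Edge c a b
  half-sound c (core x) (core y) h = coreEdge h
  half-sound c (core x) (pathT i) h with ∧-true⁻ ⌊ core-≟ {p} {q} x (inj₁ w₁) ⌋ h
  ... | x≡w₁ , i≡0 with isYes-sound (core-≟ {p} {q} x (inj₁ w₁)) x≡w₁
  ...   | refl = pathTRoot (isYes-sound (toℕ i ℕ.≟ 0) i≡0)
  half-sound c (core x) (pathS i) h with ∧-true⁻ ⌊ core-≟ {p} {q} x (inj₂ v₁) ⌋ h
  ... | x≡v₁ , i≡0 with isYes-sound (core-≟ {p} {q} x (inj₂ v₁)) x≡v₁
  ...   | refl = pathSRoot (isYes-sound (toℕ i ℕ.≟ 0) i≡0)
  half-sound c (core x) (extra y j) h with core-≟ {p} {q} x y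
  ... | yes refl = extraRoot h
  half-sound c (pathT i) (pathT j) h = pathTStep (isYes-sound (suc (toℕ i) ℕ.≟ toℕ j) h)
  half-sound c (pathS i) (pathS j) h = pathSStep (isYes-sound (suc (toℕ i) ℕ.≟ toℕ j) h)
  half-sound c (extra x i) (extra y j) h with core-≟ {p} {q} x y
  ... | yes refl = extraEdge h

  half-complete : ∀ {c a b} → Edge c a b → half c a b ≡ true
  half-complete (coreEdge h) = h
  half-complete (pathTRoot {i} h) =
    ∧-true⁺ (isYes-true (core-≟ {p} {q} (inj₁ w₁) (inj₁ w₁)) refl) (isYes-true (toℕ i ℕ.≟ 0) h)
  half-complete (pathSRoot {i} h) =
    ∧-true⁺ (isYes-true (core-≟ {p} {q} (inj₂ v₁) (inj₂ v₁)) refl) (isYes-true (toℕ i ℕ.≟ 0) h)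
  half-complete (pathTStep {i} {j} h) = isYes-true (suc (toℕ i) ℕ.≟ toℕ j) h
  half-complete (pathSStep {i} {j} h) = isYes-true (suc (toℕ i) ℕ.≟ toℕ j) h
  half-complete (extraRoot {x} h) with core-≟ {p} {q} x x
  ... | yes refl = h
  ... | no x≢x = ⊥-elim (x≢x refl)
  half-complete (extraEdge {x} h) with core-≟ {p} {q} x x
  ... | yes refl = h
  ... | no x≢x = ⊥-elim (x≢x refl)

  adjV-sound : ∀ c a b → adjV c a b ≡ true → Edge c a b ⊎ Edge c b a
  adjV-sound c a b h with ∨-true⁻ (half c a b) h
  ... | inj₁ e = inj₁ (half-sound c a b e)
  ... | inj₂ e = inj₂ (half-sound c b a e)

  adjV-complete : ∀ {c a b} → Edge c a b ⊎ Edge c b a → adjV c a b ≡ true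
  adjV-complete (inj₁ e) = ∨-trueˡ _ (half-complete e)
  adjV-complete {c} {a} {b} (inj₂ e) = ∨-trueʳ (half c a b) (half-complete e)

  adjV-sym : ∀ c a b → adjV c a b ≡ adjV c b a
  adjV-sym c a b = 𝔹P.∨-comm (half c a b) (half c b a)

  coreAdjG-₁₁⁻ : ∀ {i j} → coreAdjG (inj₁ i) (inj₁ j) ≡ true → i ≢ j
  coreAdjG-₁₁⁻ {i} h refl rewrite isYes-true (i Fin.≟ i) refl with h
  ... | ()

  coreAdjG-₂₂⁻ : ∀ {i j} → coreAdjG (inj₂ i) (inj₂ j) ≡ true → i ≢ j
  coreAdjG-₂₂⁻ {i} h refl rewrite isYes-true (i Fin.≟ i) refl with h
  ... | ()

  coreAdjG-₁₂⁻ : ∀ {i j} → coreAdjG (inj₁ i) (inj₂ j) ≡ true → i ≡ u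
  coreAdjG-₁₂⁻ = isYes-sound (_ Fin.≟ u)

  coreAdjG-₂₁⁻ : ∀ {i j} → coreAdjG (inj₂ i) (inj₁ j) ≡ true → j ≡ u
  coreAdjG-₂₁⁻ = isYes-sound (_ Fin.≟ u)

  coreAdjG′-₁₁ : ∀ {i j} → i ≢ j → coreAdjG' (inj₁ i) (inj₁ j) ≡ true
  coreAdjG′-₁₁ {i} {j} i≢j rewrite isYes-false (i Fin.≟ j) i≢j = refl

  coreAdjG′-₁₂ : ∀ i {j} → j ≢ v₁ → coreAdjG' (inj₁ i) (inj₂ j) ≡ true
  coreAdjG′-₁₂ i {j} j≢v₁ rewrite isYes-false (j Fin.≟ v₁) j≢v₁ = refl

  coreAdjG′-₂₁ : ∀ {j} i → j ≢ v₁ → coreAdjG' (inj₂ j) (inj₁ i) ≡ true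
  coreAdjG′-₂₁ {j} i j≢v₁ rewrite isYes-false (j Fin.≟ v₁) j≢v₁ = refl

  coreAdjG′-uv₁ : coreAdjG' (inj₁ u) (inj₂ v₁) ≡ true
  coreAdjG′-uv₁ rewrite isYes-true (v₁ Fin.≟ v₁) refl | isYes-true (u Fin.≟ u) refl = refl

  coreAdjG′-₂₂ : ∀ {i j} → i ≢ j → i ≢ v₁ → j ≢ v₁ → coreAdjG' (inj₂ i) (inj₂ j) ≡ true
  coreAdjG′-₂₂ {i} {j} i≢j i≢v₁ j≢v₁
    rewrite isYes-false (i Fin.≟ j) i≢j | isYes-false (i Fin.≟ v₁) i≢v₁ | isYes-false (j Fin.≟ v₁) j≢v₁ = refl

  module _ (w₁≢u : w₁ ≢ u) (m-w₁ : m (inj₁ w₁) ≡ 0) (m-v₁ : m (inj₂ v₁) ≡ 0) (s≤t : s ℕ.≤ t) where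

    onPathT : ℕ → Vtx
    onPathT = along (core (inj₁ w₁)) (t ∸ 1) pathT

    onPathS : ℕ → Vtx
    onPathS = along (core (inj₂ v₁)) (s ∸ 1) pathS

    Mapped : Vtx → Vtx → Set
    Mapped x y = x ≡ y ⊎ (Edge coreAdjG' x y ⊎ Edge coreAdjG' y x)

    WeakHomV : (Vtx → Vtx) → Set
    WeakHomV F = ∀ {a b} → Edge coreAdjG a b → Mapped (F a) (F b)

    fwd : ∀ {x y} → Edge coreAdjG' x y → Mapped x y
    fwd e = inj₂ (inj₁ e)

    bwd : ∀ {x y} → Edge coreAdjG' y x → Mapped x y
    bwd e = inj₂ (inj₂ e)

    onPathT-step : ∀ k → Mapped (onPathT k) (onPathT (suc k))
    onPathT-step k with along-step (Edge coreAdjG') pathTRoot pathTStep k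
    ... | inj₁ e = inj₁ e
    ... | inj₂ e = fwd e

    onPathS-step : ∀ k → Mapped (onPathS k) (onPathS (suc k))
    onPathS-step k with along-step (Edge coreAdjG') pathSRoot pathSStep k
    ... | inj₁ e = inj₁ e
    ... | inj₂ e = fwd e

    no-extra-at-v₁ : Fin (m (inj₂ v₁)) → ⊥
    no-extra-at-v₁ k with subst Fin m-v₁ k
    ... | ()

    no-extra-at-w₁ : Fin (m (inj₁ w₁)) → ⊥
    no-extra-at-w₁ k with subst Fin m-w₁ k
    ... | ()

    collapseX : Vtx → Vtx
    collapseX (core (inj₂ j)) with j Fin.≟ v₁
    ... | yes _ = core (inj₂ j)
    ... | no  _ = core (inj₁ u)
    collapseX (extra (inj₂ j) _) = core (inj₁ u)
    collapseX v = v

    collapseX-hom : WeakHomV collapseX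
    collapseX-hom (coreEdge {inj₁ i} {inj₁ j} h) = fwd (coreEdge (coreAdjG′-₁₁ (coreAdjG-₁₁⁻ h)))
    collapseX-hom (coreEdge {inj₁ i} {inj₂ j} h) with coreAdjG-₁₂⁻ {j = j} h | j Fin.≟ v₁
    ... | refl | yes refl = fwd (coreEdge coreAdjG′-uv₁)
    ... | refl | no _ = inj₁ refl
    collapseX-hom (coreEdge {inj₂ i} {inj₁ j} h) with coreAdjG-₂₁⁻ {i = i} h | i Fin.≟ v₁
    ... | refl | yes refl = bwd (coreEdge coreAdjG′-uv₁)
    ... | refl | no _ = inj₁ refl
    collapseX-hom (coreEdge {inj₂ i} {inj₂ j} h) with i Fin.≟ v₁ | j Fin.≟ v₁
    ... | yes refl | yes refl = inj₁ refl
    ... | yes refl | no _ = bwd (coreEdge coreAdjG′-uv₁)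
    ... | no _ | yes refl = fwd (coreEdge coreAdjG′-uv₁)
    ... | no _ | no _ = inj₁ refl
    collapseX-hom (pathTRoot h) = fwd (pathTRoot h)
    collapseX-hom (pathSRoot h) with v₁ Fin.≟ v₁
    ... | yes _ = fwd (pathSRoot h)
    ... | no v₁≢v₁ = ⊥-elim (v₁≢v₁ refl)
    collapseX-hom (pathTStep h) = fwd (pathTStep h)
    collapseX-hom (pathSStep h) = fwd (pathSStep h)
    collapseX-hom (extraRoot {inj₁ _} h) = fwd (extraRoot h)
    collapseX-hom (extraRoot {inj₂ j} {k} h) with j Fin.≟ v₁
    ... | yes refl = ⊥-elim (no-extra-at-v₁ k)
    ... | no _ = inj₁ refl
    collapseX-hom (extraEdge {inj₁ _} h) = fwd (extraEdge h)
    collapseX-hom (extraEdge {inj₂ _} h) = inj₁ refl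

    retractS : Vtx → Vtx
    retractS (core (inj₂ j)) with j Fin.≟ v₁
    ... | yes _ = core (inj₁ u)
    ... | no  _ = core (inj₂ j)
    retractS (pathS i) = onPathS (toℕ i)
    retractS v = v

    retractS-hom : WeakHomV retractS
    retractS-hom (coreEdge {inj₁ i} {inj₁ j} h) = fwd (coreEdge (coreAdjG′-₁₁ (coreAdjG-₁₁⁻ h)))
    retractS-hom (coreEdge {inj₁ i} {inj₂ j} h) with coreAdjG-₁₂⁻ {j = j} h | j Fin.≟ v₁
    ... | refl | yes refl = inj₁ refl
    ... | refl | no j≢v₁ = fwd (coreEdge (coreAdjG′-₁₂ u j≢v₁))
    retractS-hom (coreEdge {inj₂ i} {inj₁ j} h) with coreAdjG-₂₁⁻ {i = i} h | i Fin.≟ v₁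
    ... | refl | yes refl = inj₁ refl
    ... | refl | no i≢v₁ = fwd (coreEdge (coreAdjG′-₂₁ u i≢v₁))
    retractS-hom (coreEdge {inj₂ i} {inj₂ j} h) with i Fin.≟ v₁ | j Fin.≟ v₁
    ... | yes refl | yes refl = inj₁ refl
    ... | yes refl | no j≢v₁ = fwd (coreEdge (coreAdjG′-₁₂ u j≢v₁))
    ... | no i≢v₁ | yes refl = fwd (coreEdge (coreAdjG′-₂₁ u i≢v₁))
    ... | no i≢v₁ | no j≢v₁ = fwd (coreEdge (coreAdjG′-₂₂ (coreAdjG-₂₂⁻ h) i≢v₁ j≢v₁))
    retractS-hom (pathTRoot h) = fwd (pathTRoot h)
    retractS-hom (pathSRoot h) with v₁ Fin.≟ v₁
    ... | no v₁≢v₁ = ⊥-elim (v₁≢v₁ refl)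
    ... | yes _ rewrite h = fwd (coreEdge coreAdjG′-uv₁)
    retractS-hom (pathTStep h) = fwd (pathTStep h)
    retractS-hom (pathSStep {i} h) rewrite sym h = onPathS-step (toℕ i)
    retractS-hom (extraRoot {inj₁ _} h) = fwd (extraRoot h)
    retractS-hom (extraRoot {inj₂ j} {k} h) with j Fin.≟ v₁
    ... | yes refl = ⊥-elim (no-extra-at-v₁ k)
    ... | no _ = fwd (extraRoot h)
    retractS-hom (extraEdge h) = fwd (extraEdge h)

    moveSOntoT : Vtx → Vtx
    moveSOntoT (core (inj₂ j)) with j Fin.≟ v₁
    ... | yes _ = core (inj₁ w₁)
    ... | no  _ = core (inj₂ j)
    moveSOntoT (pathS i) = onPathT (suc (toℕ i))
    moveSOntoT v = v

    moveSOntoT-hom : WeakHomV moveSOntoT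
    moveSOntoT-hom (coreEdge {inj₁ i} {inj₁ j} h) = fwd (coreEdge (coreAdjG′-₁₁ (coreAdjG-₁₁⁻ h)))
    moveSOntoT-hom (coreEdge {inj₁ i} {inj₂ j} h) with coreAdjG-₁₂⁻ {j = j} h | j Fin.≟ v₁
    ... | refl | yes refl = bwd (coreEdge (coreAdjG′-₁₁ w₁≢u))
    ... | refl | no j≢v₁ = fwd (coreEdge (coreAdjG′-₁₂ u j≢v₁))
    moveSOntoT-hom (coreEdge {inj₂ i} {inj₁ j} h) with coreAdjG-₂₁⁻ {i = i} h | i Fin.≟ v₁
    ... | refl | yes refl = fwd (coreEdge (coreAdjG′-₁₁ w₁≢u))
    ... | refl | no i≢v₁ = fwd (coreEdge (coreAdjG′-₂₁ u i≢v₁))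
    moveSOntoT-hom (coreEdge {inj₂ i} {inj₂ j} h) with i Fin.≟ v₁ | j Fin.≟ v₁
    ... | yes refl | yes refl = inj₁ refl
    ... | yes refl | no j≢v₁ = fwd (coreEdge (coreAdjG′-₁₂ w₁ j≢v₁))
    ... | no i≢v₁ | yes refl = fwd (coreEdge (coreAdjG′-₂₁ w₁ i≢v₁))
    ... | no i≢v₁ | no j≢v₁ = fwd (coreEdge (coreAdjG′-₂₂ (coreAdjG-₂₂⁻ h) i≢v₁ j≢v₁))
    moveSOntoT-hom (pathTRoot h) = fwd (pathTRoot h)
    moveSOntoT-hom (pathSRoot h) with v₁ Fin.≟ v₁
    ... | no v₁≢v₁ = ⊥-elim (v₁≢v₁ refl)
    ... | yes _ rewrite h = onPathT-step 0
    moveSOntoT-hom (pathTStep h) = fwd (pathTStep h)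
    moveSOntoT-hom (pathSStep {i} h) rewrite sym h = onPathT-step (suc (toℕ i))
    moveSOntoT-hom (extraRoot {inj₁ _} h) = fwd (extraRoot h)
    moveSOntoT-hom (extraRoot {inj₂ j} {k} h) with j Fin.≟ v₁
    ... | yes refl = ⊥-elim (no-extra-at-v₁ k)
    ... | no _ = fwd (extraRoot h)
    moveSOntoT-hom (extraEdge h) = fwd (extraEdge h)

    moveTOntoS : Vtx → Vtx
    moveTOntoS (core (inj₁ i)) with i Fin.≟ w₁
    ... | yes _ = core (inj₂ v₁)
    ... | no  _ = core (inj₁ u)
    moveTOntoS (core (inj₂ j)) with j Fin.≟ v₁
    ... | yes _ = core (inj₁ u)
    ... | no  _ = core (inj₂ j)
    moveTOntoS (extra (inj₁ i) _) = core (inj₁ u)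
    moveTOntoS (pathT i) = onPathS (suc (toℕ i))
    moveTOntoS (pathS i) = onPathS (toℕ i)
    moveTOntoS v = v

    moveTOntoS-hom : WeakHomV moveTOntoS
    moveTOntoS-hom (coreEdge {inj₁ i} {inj₁ j} h) with i Fin.≟ w₁ | j Fin.≟ w₁
    ... | yes refl | yes refl = inj₁ refl
    ... | yes refl | no _ = bwd (coreEdge coreAdjG′-uv₁)
    ... | no _ | yes refl = fwd (coreEdge coreAdjG′-uv₁)
    ... | no _ | no _ = inj₁ refl
    moveTOntoS-hom (coreEdge {inj₁ i} {inj₂ j} h) with coreAdjG-₁₂⁻ {j = j} h
    ... | refl with u Fin.≟ w₁ | j Fin.≟ v₁
    ...   | yes u≡w₁ | _ = ⊥-elim (w₁≢u (sym u≡w₁))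
    ...   | no _ | yes refl = inj₁ refl
    ...   | no _ | no j≢v₁ = fwd (coreEdge (coreAdjG′-₁₂ u j≢v₁))
    moveTOntoS-hom (coreEdge {inj₂ i} {inj₁ j} h) with coreAdjG-₂₁⁻ {i = i} h
    ... | refl with u Fin.≟ w₁ | i Fin.≟ v₁
    ...   | yes u≡w₁ | _ = ⊥-elim (w₁≢u (sym u≡w₁))
    ...   | no _ | yes refl = inj₁ refl
    ...   | no _ | no i≢v₁ = fwd (coreEdge (coreAdjG′-₂₁ u i≢v₁))
    moveTOntoS-hom (coreEdge {inj₂ i} {inj₂ j} h) with i Fin.≟ v₁ | j Fin.≟ v₁
    ... | yes refl | yes refl = inj₁ refl
    ... | yes refl | no j≢v₁ = fwd (coreEdge (coreAdjG′-₁₂ u j≢v₁))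
    ... | no i≢v₁ | yes refl = fwd (coreEdge (coreAdjG′-₂₁ u i≢v₁))
    ... | no i≢v₁ | no j≢v₁ = fwd (coreEdge (coreAdjG′-₂₂ (coreAdjG-₂₂⁻ h) i≢v₁ j≢v₁))
    moveTOntoS-hom (pathTRoot h) with w₁ Fin.≟ w₁
    ... | no w₁≢w₁ = ⊥-elim (w₁≢w₁ refl)
    ... | yes _ rewrite h = onPathS-step 0
    moveTOntoS-hom (pathSRoot h) with v₁ Fin.≟ v₁
    ... | no v₁≢v₁ = ⊥-elim (v₁≢v₁ refl)
    ... | yes _ rewrite h = fwd (coreEdge coreAdjG′-uv₁)
    moveTOntoS-hom (pathTStep {i} h) rewrite sym h = onPathS-step (suc (toℕ i))
    moveTOntoS-hom (pathSStep {i} h) rewrite sym h = onPathS-step (toℕ i)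
    moveTOntoS-hom (extraRoot {inj₁ i} {k} h) with i Fin.≟ w₁
    ... | yes refl = ⊥-elim (no-extra-at-w₁ k)
    ... | no _ = inj₁ refl
    moveTOntoS-hom (extraRoot {inj₂ j} {k} h) with j Fin.≟ v₁
    ... | yes refl = ⊥-elim (no-extra-at-v₁ k)
    ... | no _ = fwd (extraRoot h)
    moveTOntoS-hom (extraEdge {inj₁ _} h) = inj₁ refl
    moveTOntoS-hom (extraEdge {inj₂ _} h) = fwd (extraEdge h)

    inX : Vtx → Bool
    inX (core (inj₂ j))    = not (j ==ᶠ v₁)
    inX (extra (inj₂ _) _) = true
    inX _                  = false

    σ : Vtx → Vtx
    σ (core (inj₁ i)) with i Fin.≟ w₁
    ... | yes _ = core (inj₂ v₁)
    ... | no  _ = core (inj₁ i)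
    σ (core (inj₂ j)) with j Fin.≟ v₁
    ... | yes _ = core (inj₁ w₁)
    ... | no  _ = core (inj₂ j)
    σ (pathS i) = onPathT (suc (toℕ i))
    σ (pathT i) with suc (toℕ i) ℕ.<? s
    ... | yes _ = onPathS (suc (toℕ i))
    ... | no  _ = pathT i
    σ v = v

    FixesX : (Vtx → Vtx) → Set
    FixesX F = ∀ a → inX a ≡ true → F a ≡ a

    retractS-fixesX : FixesX retractS
    retractS-fixesX (core (inj₂ j)) h with j Fin.≟ v₁
    ... | no _ = refl
    retractS-fixesX (extra (inj₂ _) _) _ = refl

    moveSOntoT-fixesX : FixesX moveSOntoT
    moveSOntoT-fixesX (core (inj₂ j)) h with j Fin.≟ v₁
    ... | no _ = refl
    moveSOntoT-fixesX (extra (inj₂ _) _) _ = refl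

    moveTOntoS-fixesX : FixesX moveTOntoS
    moveTOntoS-fixesX (core (inj₂ j)) h with j Fin.≟ v₁
    ... | no _ = refl
    moveTOntoS-fixesX (extra (inj₂ _) _) _ = refl

    σ-fixesX : FixesX σ
    σ-fixesX (core (inj₂ j)) h with j Fin.≟ v₁
    ... | no _ = refl
    σ-fixesX (extra (inj₂ _) _) _ = refl

    collapseX-fixes : ∀ a → inX a ≡ false → collapseX a ≡ a
    collapseX-fixes (core (inj₁ _)) _ = refl
    collapseX-fixes (core (inj₂ j)) h with j Fin.≟ v₁
    ... | yes _ = refl
    collapseX-fixes (pathT _) _ = refl
    collapseX-fixes (pathS _) _ = refl
    collapseX-fixes (extra (inj₁ _) _) _ = refl

    σ-covered : ∀ b → retractS b ≡ σ b ⊎ moveSOntoT b ≡ σ b ⊎ moveTOntoS b ≡ σ b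
    σ-covered (core (inj₁ i)) with i Fin.≟ w₁
    ... | yes _ = inj₂ (inj₂ refl)
    ... | no  _ = inj₁ refl
    σ-covered (core (inj₂ j)) with j Fin.≟ v₁
    ... | yes _ = inj₂ (inj₁ refl)
    ... | no  _ = inj₁ refl
    σ-covered (pathS i) = inj₂ (inj₁ refl)
    σ-covered (pathT i) with suc (toℕ i) ℕ.<? s
    ... | yes _ = inj₂ (inj₂ refl)
    ... | no  _ = inj₁ refl
    σ-covered (extra x k) = inj₁ refl

    σ-pathT-short : ∀ i → suc (toℕ i) ℕ.< s → σ (pathT i) ≡ onPathS (suc (toℕ i))
    σ-pathT-short i h with suc (toℕ i) ℕ.<? s
    ... | yes _ = refl
    ... | no h≮ = ⊥-elim (h≮ h)

    σ-involutive : ∀ b → σ (σ b) ≡ b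
    σ-involutive (core (inj₁ i)) with i Fin.≟ w₁
    ... | yes refl with v₁ Fin.≟ v₁
    ...   | yes _ = refl
    ...   | no v₁≢v₁ = ⊥-elim (v₁≢v₁ refl)
    σ-involutive (core (inj₁ i)) | no i≢w₁ with i Fin.≟ w₁
    ...   | yes i≡w₁ = ⊥-elim (i≢w₁ i≡w₁)
    ...   | no _ = refl
    σ-involutive (core (inj₂ j)) with j Fin.≟ v₁
    ... | yes refl with w₁ Fin.≟ w₁
    ...   | yes _ = refl
    ...   | no w₁≢w₁ = ⊥-elim (w₁≢w₁ refl)
    σ-involutive (core (inj₂ j)) | no j≢v₁ with j Fin.≟ v₁
    ...   | yes j≡v₁ = ⊥-elim (j≢v₁ j≡v₁)
    ...   | no _ = refl
    σ-involutive (pathS i) = goal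
      where
        k<s-1 : toℕ i ℕ.< s ∸ 1
        k<s-1 = FinP.toℕ<n i
        k<t-1 : toℕ i ℕ.< t ∸ 1
        k<t-1 = ℕP.<-≤-trans k<s-1 (ℕP.∸-monoˡ-≤ 1 s≤t)
        goal : σ (onPathT (suc (toℕ i))) ≡ pathS i
        goal rewrite along-suc (core (inj₁ w₁)) (t ∸ 1) pathT k<t-1
                   | σ-pathT-short (Fin.fromℕ< k<t-1)
                       (subst (λ z → suc z ℕ.< s) (sym (FinP.toℕ-fromℕ< k<t-1)) (<-pred⇒suc< s k<s-1))
                   | FinP.toℕ-fromℕ< k<t-1
                   | along-suc (core (inj₂ v₁)) (s ∸ 1) pathS k<s-1 = cong pathS (FinP.fromℕ<-toℕ i k<s-1)
    σ-involutive (pathT i) with suc (toℕ i) ℕ.<? s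
    ... | no k+1≮s with suc (toℕ i) ℕ.<? s
    ...   | yes k+1<s = ⊥-elim (k+1≮s k+1<s)
    ...   | no _ = refl
    σ-involutive (pathT i) | yes k+1<s = goal
      where
        k<s-1 : toℕ i ℕ.< s ∸ 1
        k<s-1 = suc<⇒<-pred s k+1<s
        k<t-1 : toℕ i ℕ.< t ∸ 1
        k<t-1 = ℕP.<-≤-trans k<s-1 (ℕP.∸-monoˡ-≤ 1 s≤t)
        goal : σ (onPathS (suc (toℕ i))) ≡ pathT i
        goal rewrite along-suc (core (inj₂ v₁)) (s ∸ 1) pathS k<s-1
                   | FinP.toℕ-fromℕ< k<s-1
                   | along-suc (core (inj₁ w₁)) (t ∸ 1) pathT k<t-1 = cong pathT (FinP.fromℕ<-toℕ i k<t-1)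
    σ-involutive (extra x k) = refl

    v₁∉X : inX (core (inj₂ v₁)) ≡ false
    v₁∉X rewrite isYes-true (v₁ Fin.≟ v₁) refl = refl

    inX-σ : ∀ b → inX (σ b) ≡ inX b
    inX-σ (core (inj₁ i)) with i Fin.≟ w₁
    ... | yes _ = v₁∉X
    ... | no  _ = refl
    inX-σ (core (inj₂ j)) with j Fin.≟ v₁
    ... | yes refl = refl
    ... | no j≢v₁ rewrite isYes-false (j Fin.≟ v₁) j≢v₁ = refl
    inX-σ (pathS i) = along-all (λ v → inX v ≡ false) {P = pathT} refl (λ _ → refl) (suc (toℕ i))
    inX-σ (pathT i) with suc (toℕ i) ℕ.<? s
    ... | yes _ = along-all (λ v → inX v ≡ false) {P = pathS} v₁∉X (λ _ → refl) (suc (toℕ i))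
    ... | no  _ = refl
    inX-σ (extra x k) = refl

    onFin : (Vtx → Vtx) → Fin N → Fin N
    onFin F i = index (F (vertex i))

    mapped-sym : ∀ {x y} → Mapped x y → Mapped y x
    mapped-sym (inj₁ x≡y) = inj₁ (sym x≡y)
    mapped-sym (inj₂ e) = inj₂ (swap e)

    index-mapped : ∀ {x y} → Mapped x y → index x ≡ index y ⊎ adjG' (index x) (index y) ≡ true
    index-mapped (inj₁ refl) = inj₁ refl
    index-mapped {x} {y} (inj₂ e) rewrite vertex-index x | vertex-index y = inj₂ (adjV-complete e)

    onFin-weakHom : ∀ {F} → WeakHomV F → WeakHom adjG adjG' (onFin F)
    onFin-weakHom {F} F-hom a b h with adjV-sound coreAdjG (vertex a) (vertex b) h
    ... | inj₁ e = index-mapped (F-hom e)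
    ... | inj₂ e = index-mapped (mapped-sym (F-hom e))

    X : Fin N → Bool
    X i = inX (vertex i)

    φ : FinAdj N → Fin N → Fin N → ℚ
    φ B i j = recip (dist B i j)

    φ-outside-X : ∀ i j → X i ≡ false → X j ≡ false → φ adjG i j ℚ.≤ φ adjG' i j
    φ-outside-X i j i∉X j∉X = recip-dist-anti adjG adjG' closer (λ i≡j → i≡j)
      where
        fixed : ∀ k → X k ≡ false → onFin collapseX k ≡ k
        fixed k k∉X = trans (cong index (collapseX-fixes (vertex k) k∉X)) (index-vertex k)
        closer : dist adjG' i j ℕ.≤ dist adjG i j
        closer = subst₂ (λ a b → dist adjG' a b ℕ.≤ dist adjG i j) (fixed i i∉X) (fixed j j∉X)
                   (dist-map (onFin-weakHom collapseX-hom) i j)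

    σᶠ : Fin N → Fin N
    σᶠ = onFin σ

    σᶠ-involutive : ∀ j → σᶠ (σᶠ j) ≡ j
    σᶠ-involutive j rewrite vertex-index (σ (vertex j)) | σ-involutive (vertex j) = index-vertex j

    σᶠ-fixesX : ∀ i → X i ≡ true → σᶠ i ≡ i
    σᶠ-fixesX i i∈X = trans (cong index (σ-fixesX (vertex i) i∈X)) (index-vertex i)

    X-σᶠ : ∀ j → X (σᶠ j) ≡ X j
    X-σᶠ j rewrite vertex-index (σ (vertex j)) = inX-σ (vertex j)

    σᶠ-perm : Permutation′ N
    σᶠ-perm = permutation σᶠ σᶠ σᶠ-involutive σᶠ-involutive

    φ-from-X : ∀ i j → X i ≡ true → φ adjG i j ℚ.≤ φ adjG' i (σᶠ j)
    φ-from-X i j i∈X = recip-dist-anti adjG adjG' closer back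
      where
        via : ∀ {F} → WeakHomV F → FixesX F → F (vertex j) ≡ σ (vertex j) →
          dist adjG' i (σᶠ j) ℕ.≤ dist adjG i j
        via {F} F-hom F-fixes Fj≡σj =
          subst₂ (λ a b → dist adjG' a b ℕ.≤ dist adjG i j)
            (trans (cong index (F-fixes (vertex i) i∈X)) (index-vertex i)) (cong index Fj≡σj)
            (dist-map (onFin-weakHom F-hom) i j)
        closer : dist adjG' i (σᶠ j) ℕ.≤ dist adjG i j
        closer with σ-covered (vertex j)
        ... | inj₁ e = via retractS-hom retractS-fixesX e
        ... | inj₂ (inj₁ e) = via moveSOntoT-hom moveSOntoT-fixesX e
        ... | inj₂ (inj₂ e) = via moveTOntoS-hom moveTOntoS-fixesX e
        back : i ≡ σᶠ j → i ≡ j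
        back i≡σj = trans (sym (σᶠ-fixesX i i∈X)) (trans (cong σᶠ i≡σj) (σᶠ-involutive j))

    from-X-row : ∀ i → X i ≡ true → ∀ j →
      weight true (X j) (φ adjG i j) ℚ.≤ weight true (X (σᶠ j)) (φ adjG' i (σᶠ j))
    from-X-row i i∈X j rewrite X-σᶠ j = weight-mono true (X j) (φ-from-X i j i∈X)

    row-≤ : ∀ i → sum (λ j → weight (X i) (X j) (φ adjG i j)) ℚ.≤ sum (λ j → weight (X i) (X j) (φ adjG' i j))
    row-≤ i with X i in i∈X
    ... | true = sum-≤-permuted σᶠ-perm (from-X-row i i∈X)
    ... | false = sum-mono outside
      where
        outside : ∀ j → weight false (X j) (φ adjG i j) ℚ.≤ weight false (X j) (φ adjG' i j)
        outside j with X j in j∉X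
        ... | true = ℚP.≤-refl
        ... | false = φ-outside-X i j i∈X j∉X

    module _ (3≤p : 3 ℕ.≤ p) (3≤q : 3 ℕ.≤ q) where

      j₀ : Fin (q ∸ 1)
      j₀ = proj₁ (fin-other (q ∸ 1) (ℕP.∸-monoˡ-≤ 1 3≤q) v₁)

      j₀≢v₁ : j₀ ≢ v₁
      j₀≢v₁ = proj₂ (fin-other (q ∸ 1) (ℕP.∸-monoˡ-≤ 1 3≤q) v₁)

      i₀ : Fin p
      i₀ = proj₁ (fin-other₂ p 3≤p u w₁)

      i₀≢u : i₀ ≢ u
      i₀≢u = proj₁ (proj₂ (fin-other₂ p 3≤p u w₁))

      i₀≢w₁ : i₀ ≢ w₁
      i₀≢w₁ = proj₂ (proj₂ (fin-other₂ p 3≤p u w₁))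

      x₀ y₀ : Fin N
      x₀ = index (core (inj₂ j₀))
      y₀ = index (core (inj₁ i₀))

      x₀∈X : X x₀ ≡ true
      x₀∈X rewrite vertex-index (core (inj₂ j₀)) | isYes-false (j₀ Fin.≟ v₁) j₀≢v₁ = refl

      y₀∉X : X y₀ ≡ false
      y₀∉X rewrite vertex-index (core (inj₁ i₀)) = refl

      σᶠ-y₀ : σᶠ y₀ ≡ y₀
      σᶠ-y₀ rewrite vertex-index (core (inj₁ i₀)) with i₀ Fin.≟ w₁
      ... | yes i₀≡w₁ = ⊥-elim (i₀≢w₁ i₀≡w₁)
      ... | no _ = refl

      x₀≢y₀ : x₀ ≢ y₀
      x₀≢y₀ x₀≡y₀ with trans (sym (vertex-index (core (inj₂ j₀)))) (trans (cong vertex x₀≡y₀) (vertex-index (core (inj₁ i₀))))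
      ... | ()

      x₀y₀-nonadjacent : adjG x₀ y₀ ≡ false
      x₀y₀-nonadjacent rewrite vertex-index (core (inj₂ j₀)) | vertex-index (core (inj₁ i₀))
                             | isYes-false (i₀ Fin.≟ u) i₀≢u = refl

      x₀y₀-adjacent′ : adjG' x₀ y₀ ≡ true
      x₀y₀-adjacent′ rewrite vertex-index (core (inj₂ j₀)) | vertex-index (core (inj₁ i₀)) =
        adjV-complete {coreAdjG'} {core (inj₂ j₀)} {core (inj₁ i₀)} (inj₁ (coreEdge (coreAdjG′-₂₁ i₀ j₀≢v₁)))

      φ-x₀y₀ : φ adjG x₀ y₀ ℚ.< φ adjG' x₀ y₀
      φ-x₀y₀ rewrite dist-adjacent adjG' x₀≢y₀ x₀y₀-adjacent′ =
        recip-<-recip1 (dist-nonadjacent adjG x₀≢y₀ x₀y₀-nonadjacent)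

      row-< : sum (λ j → weight (X x₀) (X j) (φ adjG x₀ j)) ℚ.< sum (λ j → weight (X x₀) (X j) (φ adjG' x₀ j))
      row-< rewrite x₀∈X = sum-<-permuted σᶠ-perm (from-X-row x₀ x₀∈X) y₀ at-y₀
        where
          at-y₀ : weight true (X y₀) (φ adjG x₀ y₀) ℚ.< weight true (X (σᶠ y₀)) (φ adjG' x₀ (σᶠ y₀))
          at-y₀ rewrite σᶠ-y₀ | y₀∉X = ℚP.+-mono-< φ-x₀y₀ φ-x₀y₀

      harary-increases : HG ℚ.< HG'
      harary-increases = double-<-cancel (subst₂ ℚ._<_
        (sym (harary-doubled adjG (λ i j → adjV-sym coreAdjG (vertex i) (vertex j)) X))
        (sym (harary-doubled adjG' (λ i j → adjV-sym coreAdjG' (vertex i) (vertex j)) X))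
        (sum-mono-< row-≤ x₀ row-<))

mainTheorem2 : (p q t s : ℕ) → 3 ≤ p → 3 ≤ q → 1 ≤ s → s ≤ t →
    (u w₁ : Fin p) → w₁ ≢ u → (v₁ : Fin (q ∸ 1)) →
    (m : Core p q → ℕ) → (A : (x : Core p q) → FinAdj (suc (m x))) →
    (∀ x → IsSimple (A x)) → (∀ x → Connected (A x)) →
    m (inj₁ u) ≡ 0 → m (inj₁ w₁) ≡ 0 → m (inj₂ v₁) ≡ 0 →
    Construction.HG p q t s u w₁ v₁ m A < Construction.HG' p q t s u w₁ v₁ m A
mainTheorem2 p q t s 3≤p 3≤q _ s≤t u w₁ w₁≢u v₁ m A _ _ _ m-w₁ m-v₁ =
  Transformation.harary-increases p q t s u w₁ v₁ m A w₁≢u m-w₁ m-v₁ s≤t 3≤p 3≤q
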